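{- Let $X$ be a super $X$-set parameter and let $G$ be a graph of order $n$. Then $\Delta(\mathfrak{X}(G))=n$ if and only if every set of $n-1$ vertices of $G$ is an $X$-set of $G$.
   Context: All graphs are finite, simple, undirected, with nonempty vertex set. A vertex set property assigns to each graph $G$ a family of subsets of $V(G)$ (its members are called the $X$-sets of $G$) in a way that is invariant under graph isomorphism; it is cohesive if every graph has at least one $X$-set. A super $X$-set parameter is a cohesive vertex set property satisfying the Superset axiom: if $S$ is an $X$-set of $G$ and $S\subseteq S'\subseteq V(G)$, then $S'$ is an $X$-set of $G$; the parameter value $X(G)$ is the minimum cardinality of an $X$-set of $G$. The $X$-TAR graph $\mathfrak{X}(G)$ has as vertices the $X$-sets of $G$, with $S_1,S_2$ adjacent if and only if $|S_1\ominus S_2|=1$ (symmetric difference). $\Delta(H)$ denotes the maximum degree of a graph $H$. -}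

module Defs where

open import Data.Bool using (Bool; true; false; _∧_)
open import Data.Nat using (ℕ; zero; suc; _≡ᵇ_; _⊔_)
open import Data.Fin using (Fin)
open import Data.Fin.Subset using (Subset; _⊆_; _∪_; _─_; ∣_∣)
open import Data.Fin.Permutation using (Permutation′; _⟨$⟩ʳ_; _⟨$⟩ˡ_)
open import Data.Vec using (Vec; []; _∷_; tabulate; lookup)
open import Data.List using (List; []; _∷_; map; _++_; filter; length; foldr)
open import Relation.Binary.PropositionalEquality using (_≡_)
open import Relation.Nullary.Decidable using (Dec)
open import Data.Bool using (T?)

record Graph (n : ℕ) : Set where
  field
    adj   : Fin n → Fin n → Bool
    sym   : ∀ i j → adj i j ≡ adj j i
    irrefl : ∀ i → adj i i ≡ false
open Graph public

-- Graphs have nonempty vertex set, so we index by order suc m.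
-- A vertex set property: for each graph, the (finite) family of its X-sets,
-- given by its characteristic function.
VertexSetProperty : Set
VertexSetProperty = (m : ℕ) → Graph (suc m) → Subset (suc m) → Bool

image : ∀ {n} → Permutation′ n → Subset n → Subset n
image π S = tabulate (λ j → lookup S (π ⟨$⟩ˡ j))

IsIso : ∀ {n} → Graph n → Graph n → Permutation′ n → Set
IsIso G H π = ∀ i j → adj H (π ⟨$⟩ʳ i) (π ⟨$⟩ʳ j) ≡ adj G i j

IsoInvariant : VertexSetProperty → Set
IsoInvariant X = ∀ m (G H : Graph (suc m)) (π : Permutation′ (suc m)) →
  IsIso G H π → ∀ S → X m H (image π S) ≡ X m G S

Cohesive : VertexSetProperty → Set
Cohesive X = ∀ m (G : Graph (suc m)) → Data.Product.Σ (Subset (suc m)) (λ S → X m G S ≡ true)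
  where import Data.Product

SupersetAxiom : VertexSetProperty → Set
SupersetAxiom X = ∀ m (G : Graph (suc m)) (S S′ : Subset (suc m)) →
  X m G S ≡ true → S ⊆ S′ → X m G S′ ≡ true

record SuperParameter : Set where
  field
    X         : VertexSetProperty
    invariant : IsoInvariant X
    cohesive  : Cohesive X
    superset  : SupersetAxiom X
open SuperParameter public

allSubsets : (n : ℕ) → List (Subset n)
allSubsets zero = [] ∷ []
allSubsets (suc n) = map (false ∷_) (allSubsets n) ++ map (true ∷_) (allSubsets n)

_⊖_ : ∀ {n} → Subset n → Subset n → Subset n
p ⊖ q = (p ─ q) ∪ (q ─ p)

-- X-sets of G (vertices of the X-TAR graph)
xSets : (P : SuperParameter) (m : ℕ) (G : Graph (suc m)) → List (Subset (suc m))
xSets P m G = filter (λ S → T? (X P m G S)) (allSubsets (suc m))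

-- degree of vertex S in the X-TAR graph: number of X-sets S′ with |S ⊖ S′| = 1
tarDegree : (P : SuperParameter) (m : ℕ) (G : Graph (suc m)) → Subset (suc m) → ℕ
tarDegree P m G S = length (filter (λ S′ → T? (∣ S ⊖ S′ ∣ ≡ᵇ 1)) (xSets P m G))

-- maximum degree Δ of the X-TAR graph (its vertex set is nonempty by cohesiveness)
tarMaxDegree : (P : SuperParameter) (m : ℕ) (G : Graph (suc m)) → ℕ
tarMaxDegree P m G = foldr (λ S d → tarDegree P m G S ⊔ d) 0 (xSets P m G)

-- An X-set S is adjacent in the X-TAR graph only to X-sets at Hamming distance 1, so its
-- degree is at most the hypercube degree n, with equality iff all n neighbours of S are
-- X-sets. If every (n-1)-set is an X-set, then V(G) is one by the Superset axiom, and its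
-- neighbours are exactly the (n-1)-sets, so Δ = n. Conversely, if some X-set S has degree
-- n, every (n-1)-set T either contains S or contains the neighbour of S obtained by
-- deleting the vertex missing from T; either way T is an X-set by the Superset axiom.
module Submission where

open import Defs hiding (sym)
open import Data.Bool using (true; false; T)
open import Data.Bool.Properties using (T-≡)
open import Data.Nat using (ℕ; zero; suc; _+_; _≤_; _≡ᵇ_; _⊔_; z≤n)
open import Data.Nat.Properties
  using (module ≤-Reasoning; ≡ᵇ⇒≡; ≡⇒≡ᵇ; ≤-antisym; ≤-trans; +-comm; +-suc; suc-injective; ⊔-lub; ⊔-sel; m≤m⊔n; m≤n⊔m)
open import Data.Nat.Combinatorics using (_C_; nC1≡n; nCk+nC[k+1]≡[n+1]C[k+1])
open import Data.Vec using ([]; _∷_)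
open import Data.Fin.Subset using (Subset; ∣_∣; _⊆_; ⊤; outside; inside)
open import Data.Fin.Subset.Properties using (⊆⊤; s⊆s; out⊆; ∣p∣≡n⇒p≡⊤)
open import Data.List using (List; []; _∷_; map; _++_; filter; length; foldr)
open import Data.List.Properties using (length-++; filter-++; filter-none; filter-all; filter-complete; length-filter)
open import Data.List.Membership.Propositional using (_∈_)
open import Data.List.Membership.Propositional.Properties using (∈-filter⁺; ∈-filter⁻; ∈-++⁺ˡ; ∈-++⁺ʳ; ∈-map⁺)
open import Data.List.Relation.Unary.Any using (here; there)
open import Data.List.Relation.Unary.All as All using (All)
open import Data.List.Relation.Unary.All.Properties using (all-filter)
open import Data.Product using (∃-syntax; _,_; _×_; proj₂)
open import Data.Sum using (_⊎_; inj₁; inj₂)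
open import Function using (_∘_)
open import Function.Bundles using (_⇔_; mk⇔; Equivalence)
open import Relation.Nullary.Decidable using (T?; does)
open import Relation.Unary using (Pred; Decidable)
open import Relation.Binary.PropositionalEquality using (_≡_; refl; sym; trans; cong; cong₂; subst; module ≡-Reasoning)

private
  variable
    A B : Set
    n : ℕ

module _ {p q} {P : Pred A p} {Q : Pred A q} (P? : Decidable P) (Q? : Decidable Q) where

  filter-comm : ∀ xs → filter P? (filter Q? xs) ≡ filter Q? (filter P? xs)
  filter-comm [] = refl
  filter-comm (x ∷ xs) with does (Q? x) in Qx
  ... | false with does (P? x)
  ...   | false = filter-comm xs
  ...   | true rewrite Qx = filter-comm xs
  filter-comm (x ∷ xs) | true with does (P? x)
  ...   | false = filter-comm xs
  ...   | true rewrite Qx = cong (x ∷_) (filter-comm xs)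

length-filter-map : ∀ {p} {P : Pred B p} (P? : Decidable P) (f : A → B) xs →
  length (filter P? (map f xs)) ≡ length (filter (P? ∘ f) xs)
length-filter-map P? f [] = refl
length-filter-map P? f (x ∷ xs) with does (P? (f x))
... | false = length-filter-map P? f xs
... | true  = cong suc (length-filter-map P? f xs)

length-filter-const-false : (xs : List A) → length (filter (λ _ → T? false) xs) ≡ 0
length-filter-const-false xs = cong length (filter-none (λ _ → T? false) (All.universal (λ _ ()) xs))

maxOver : (A → ℕ) → List A → ℕ
maxOver f = foldr (λ x d → f x ⊔ d) 0

module _ (f : A → ℕ) where

  maxOver-lub : ∀ {k} xs → (∀ x → x ∈ xs → f x ≤ k) → maxOver f xs ≤ k
  maxOver-lub [] _ = z≤n
  maxOver-lub (x ∷ xs) h = ⊔-lub (h x (here refl)) (maxOver-lub xs (λ y y∈ → h y (there y∈)))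

  ≤-maxOver : ∀ {x} xs → x ∈ xs → f x ≤ maxOver f xs
  ≤-maxOver (x ∷ xs) (here refl) = m≤m⊔n (f x) (maxOver f xs)
  ≤-maxOver (y ∷ xs) (there x∈) = ≤-trans (≤-maxOver xs x∈) (m≤n⊔m (f y) (maxOver f xs))

  maxOver-attained : ∀ {k} xs → maxOver f xs ≡ suc k → ∃[ x ] x ∈ xs × f x ≡ suc k
  maxOver-attained (x ∷ xs) eq with ⊔-sel (f x) (maxOver f xs)
  ... | inj₁ max≡fx = x , here refl , trans (sym max≡fx) eq
  ... | inj₂ max≡rest with maxOver-attained xs (trans (sym max≡rest) eq)
  ...   | y , y∈ , fy≡ = y , there y∈ , fy≡

∈-allSubsets : (S : Subset n) → S ∈ allSubsets n
∈-allSubsets [] = here refl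
∈-allSubsets {suc n} (outside ∷ S) = ∈-++⁺ˡ (∈-map⁺ (outside ∷_) (∈-allSubsets S))
∈-allSubsets {suc n} (inside ∷ S) =
  ∈-++⁺ʳ (map (outside ∷_) (allSubsets n)) (∈-map⁺ (inside ∷_) (∈-allSubsets S))

length-filter-allSubsets : ∀ {p} {P : Pred (Subset (suc n)) p} (P? : Decidable P) →
  length (filter P? (allSubsets (suc n))) ≡
  length (filter (P? ∘ (outside ∷_)) (allSubsets n)) + length (filter (P? ∘ (inside ∷_)) (allSubsets n))
length-filter-allSubsets {n} P? = begin
  length (filter P? (map (outside ∷_) (allSubsets n) ++ map (inside ∷_) (allSubsets n)))
    ≡⟨ cong length (filter-++ P? (map (outside ∷_) (allSubsets n)) _) ⟩
  length (filter P? (map (outside ∷_) (allSubsets n)) ++ filter P? (map (inside ∷_) (allSubsets n)))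
    ≡⟨ length-++ (filter P? (map (outside ∷_) (allSubsets n))) ⟩
  length (filter P? (map (outside ∷_) (allSubsets n))) + length (filter P? (map (inside ∷_) (allSubsets n)))
    ≡⟨ cong₂ _+_ (length-filter-map P? (outside ∷_) (allSubsets n))
                 (length-filter-map P? (inside ∷_) (allSubsets n)) ⟩
  length (filter (P? ∘ (outside ∷_)) (allSubsets n)) + length (filter (P? ∘ (inside ∷_)) (allSubsets n))
    ∎
  where open ≡-Reasoning

at-distance? : (k : ℕ) (S : Subset n) → Decidable (λ S′ → T (∣ S ⊖ S′ ∣ ≡ᵇ k))
at-distance? k S S′ = T? (∣ S ⊖ S′ ∣ ≡ᵇ k)

sphere : ℕ → Subset n → List (Subset n)
sphere k S = filter (at-distance? k S) (allSubsets _)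

∣sphere₀∣≡1 : (S : Subset n) → length (sphere 0 S) ≡ 1
∣sphere₀∣≡1 [] = refl
∣sphere₀∣≡1 {suc n} (outside ∷ S) = begin
  length (sphere 0 (outside ∷ S))
    ≡⟨ length-filter-allSubsets (at-distance? 0 (outside ∷ S)) ⟩
  length (sphere 0 S) + length (filter (λ _ → T? false) (allSubsets n))
    ≡⟨ cong₂ _+_ (∣sphere₀∣≡1 S) (length-filter-const-false (allSubsets n)) ⟩
  1 ∎
  where open ≡-Reasoning
∣sphere₀∣≡1 {suc n} (inside ∷ S) = begin
  length (sphere 0 (inside ∷ S))
    ≡⟨ length-filter-allSubsets (at-distance? 0 (inside ∷ S)) ⟩
  length (filter (λ _ → T? false) (allSubsets n)) + length (sphere 0 S)
    ≡⟨ cong₂ _+_ (length-filter-const-false (allSubsets n)) (∣sphere₀∣≡1 S) ⟩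
  1 ∎
  where open ≡-Reasoning

-- A set at distance k+1 from b ∷ S either keeps the head b (distance k+1 from S) or flips it
-- (distance k from S), so the sphere sizes obey Pascal's rule.
∣sphere∣≡C : ∀ k (S : Subset n) → length (sphere k S) ≡ n C k
∣sphere∣≡C zero S = ∣sphere₀∣≡1 S
∣sphere∣≡C (suc k) [] = refl
∣sphere∣≡C {suc n} (suc k) (outside ∷ S) = begin
  length (sphere (suc k) (outside ∷ S))
    ≡⟨ length-filter-allSubsets (at-distance? (suc k) (outside ∷ S)) ⟩
  length (sphere (suc k) S) + length (sphere k S)
    ≡⟨ cong₂ _+_ (∣sphere∣≡C (suc k) S) (∣sphere∣≡C k S) ⟩
  n C suc k + n C k
    ≡⟨ +-comm (n C suc k) (n C k) ⟩
  n C k + n C suc k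
    ≡⟨ nCk+nC[k+1]≡[n+1]C[k+1] n k ⟩
  suc n C suc k ∎
  where open ≡-Reasoning
∣sphere∣≡C {suc n} (suc k) (inside ∷ S) = begin
  length (sphere (suc k) (inside ∷ S))
    ≡⟨ length-filter-allSubsets (at-distance? (suc k) (inside ∷ S)) ⟩
  length (sphere k S) + length (sphere (suc k) S)
    ≡⟨ cong₂ _+_ (∣sphere∣≡C k S) (∣sphere∣≡C (suc k) S) ⟩
  n C k + n C suc k
    ≡⟨ nCk+nC[k+1]≡[n+1]C[k+1] n k ⟩
  suc n C suc k ∎
  where open ≡-Reasoning

∣sphere₁∣≡n : (S : Subset n) → length (sphere 1 S) ≡ n
∣sphere₁∣≡n {n} S = trans (∣sphere∣≡C 1 S) (nC1≡n n)

∈-sphere⁻ : ∀ {k} {S S′ : Subset n} → S′ ∈ sphere k S → ∣ S ⊖ S′ ∣ ≡ k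
∈-sphere⁻ {n} {k} {S} S′∈ = ≡ᵇ⇒≡ _ k (proj₂ (∈-filter⁻ (at-distance? k S) {xs = allSubsets n} S′∈))

∈-sphere⁺ : ∀ {k} {S S′ : Subset n} → ∣ S ⊖ S′ ∣ ≡ k → S′ ∈ sphere k S
∈-sphere⁺ {k = k} {S} {S′} d = ∈-filter⁺ (at-distance? k S) (∈-allSubsets S′) (≡⇒≡ᵇ _ k d)

∣∷⊖∷∣ : ∀ b (S S′ : Subset n) → ∣ (b ∷ S) ⊖ (b ∷ S′) ∣ ≡ ∣ S ⊖ S′ ∣
∣∷⊖∷∣ outside S S′ = refl
∣∷⊖∷∣ inside  S S′ = refl

∣p⊖p∣≡0 : (S : Subset n) → ∣ S ⊖ S ∣ ≡ 0
∣p⊖p∣≡0 [] = refl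
∣p⊖p∣≡0 (b ∷ S) = trans (∣∷⊖∷∣ b S S) (∣p⊖p∣≡0 S)

∣⊤⊖p∣+∣p∣≡n : (S : Subset n) → ∣ ⊤ ⊖ S ∣ + ∣ S ∣ ≡ n
∣⊤⊖p∣+∣p∣≡n [] = refl
∣⊤⊖p∣+∣p∣≡n (outside ∷ S) = cong suc (∣⊤⊖p∣+∣p∣≡n S)
∣⊤⊖p∣+∣p∣≡n (inside ∷ S) = trans (+-suc ∣ ⊤ ⊖ S ∣ ∣ S ∣) (cong suc (∣⊤⊖p∣+∣p∣≡n S))

∣q∣≡n⇒p⊆q : ∀ {S T : Subset n} → ∣ T ∣ ≡ n → S ⊆ T
∣q∣≡n⇒p⊆q {S = S} ∣T∣≡n = subst (S ⊆_) (sym (∣p∣≡n⇒p≡⊤ ∣T∣≡n)) ⊆⊤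

∷⊆inside∷ : ∀ b {S T : Subset n} → S ⊆ T → (b ∷ S) ⊆ (inside ∷ T)
∷⊆inside∷ outside = out⊆
∷⊆inside∷ inside  = s⊆s

⊆-or-adjacent-⊆ : (S T : Subset (suc n)) → ∣ T ∣ ≡ n →
  S ⊆ T ⊎ ∃[ S′ ] ∣ S ⊖ S′ ∣ ≡ 1 × S′ ⊆ T
⊆-or-adjacent-⊆ (outside ∷ S) (outside ∷ T) ∣T∣≡n = inj₁ (out⊆ (∣q∣≡n⇒p⊆q ∣T∣≡n))
⊆-or-adjacent-⊆ (inside ∷ S) (outside ∷ T) ∣T∣≡n =
  inj₂ (outside ∷ S , cong suc (∣p⊖p∣≡0 S) , out⊆ (∣q∣≡n⇒p⊆q ∣T∣≡n))
⊆-or-adjacent-⊆ {suc n} (b ∷ S) (inside ∷ T) ∣T∣≡n with ⊆-or-adjacent-⊆ S T (suc-injective ∣T∣≡n)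
... | inj₁ S⊆T = inj₁ (∷⊆inside∷ b S⊆T)
... | inj₂ (S′ , d , S′⊆T) = inj₂ (b ∷ S′ , trans (∣∷⊖∷∣ b S S′) d , ∷⊆inside∷ b S′⊆T)

∣⊤⊖p∣≡1⇒∣p∣≡n : (S : Subset (suc n)) → ∣ ⊤ ⊖ S ∣ ≡ 1 → ∣ S ∣ ≡ n
∣⊤⊖p∣≡1⇒∣p∣≡n S d = suc-injective (trans (cong (_+ ∣ S ∣) (sym d)) (∣⊤⊖p∣+∣p∣≡n S))

module XTAR (P : SuperParameter) (m : ℕ) (G : Graph (suc m)) where

  isXSet? : Decidable (λ S → T (X P m G S))
  isXSet? S = T? (X P m G S)

  ∈-xSets⁻ : ∀ {S} → S ∈ xSets P m G → X P m G S ≡ true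
  ∈-xSets⁻ S∈ = Equivalence.to T-≡ (proj₂ (∈-filter⁻ isXSet? {xs = allSubsets (suc m)} S∈))

  ∈-xSets⁺ : ∀ {S} → X P m G S ≡ true → S ∈ xSets P m G
  ∈-xSets⁺ {S} XS = ∈-filter⁺ isXSet? (∈-allSubsets S) (Equivalence.from T-≡ XS)

  ⊤-isXSet : X P m G ⊤ ≡ true
  ⊤-isXSet with cohesive P m G
  ... | S , XS = superset P m G S ⊤ XS ⊆⊤

  tarDegree≡∣X∩sphere₁∣ : ∀ S → tarDegree P m G S ≡ length (filter isXSet? (sphere 1 S))
  tarDegree≡∣X∩sphere₁∣ S = cong length (filter-comm (at-distance? 1 S) isXSet? (allSubsets (suc m)))

  tarDegree≤n : ∀ S → tarDegree P m G S ≤ suc m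
  tarDegree≤n S = begin
    tarDegree P m G S                      ≡⟨ tarDegree≡∣X∩sphere₁∣ S ⟩
    length (filter isXSet? (sphere 1 S))   ≤⟨ length-filter isXSet? (sphere 1 S) ⟩
    length (sphere 1 S)                    ≡⟨ ∣sphere₁∣≡n S ⟩
    suc m                                  ∎
    where open ≤-Reasoning

  tarDegree≡n⇔neighbours-XSets : ∀ S →
    tarDegree P m G S ≡ suc m ⇔ (∀ S′ → ∣ S ⊖ S′ ∣ ≡ 1 → X P m G S′ ≡ true)
  tarDegree≡n⇔neighbours-XSets S = mk⇔ full⇒all all⇒full
    where
    full⇒all : tarDegree P m G S ≡ suc m → ∀ S′ → ∣ S ⊖ S′ ∣ ≡ 1 → X P m G S′ ≡ true
    full⇒all deg≡n S′ d = Equivalence.to T-≡ (All.lookup allX (∈-sphere⁺ {S = S} d))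
      where
      filter≡ : filter isXSet? (sphere 1 S) ≡ sphere 1 S
      filter≡ = filter-complete isXSet?
        (trans (sym (tarDegree≡∣X∩sphere₁∣ S)) (trans deg≡n (sym (∣sphere₁∣≡n S))))
      allX : All (λ S → T (X P m G S)) (sphere 1 S)
      allX = subst (All _) filter≡ (all-filter isXSet? (sphere 1 S))

    all⇒full : (∀ S′ → ∣ S ⊖ S′ ∣ ≡ 1 → X P m G S′ ≡ true) → tarDegree P m G S ≡ suc m
    all⇒full h = begin
      tarDegree P m G S                      ≡⟨ tarDegree≡∣X∩sphere₁∣ S ⟩
      length (filter isXSet? (sphere 1 S))   ≡⟨ cong length (filter-all isXSet? allX) ⟩
      length (sphere 1 S)                    ≡⟨ ∣sphere₁∣≡n S ⟩
      suc m                                  ∎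
      where
      open ≡-Reasoning
      allX : All (λ S → T (X P m G S)) (sphere 1 S)
      allX = All.tabulate (λ S′∈ → Equivalence.from T-≡ (h _ (∈-sphere⁻ {S = S} S′∈)))

proposition2p14 : (P : SuperParameter) (m : ℕ) (G : Graph (suc m)) →
    (tarMaxDegree P m G ≡ suc m) ⇔ (∀ (S : Subset (suc m)) → ∣ S ∣ ≡ m → X P m G S ≡ true)
proposition2p14 P m G = mk⇔ Δ≡n⇒cosingletons cosingletons⇒Δ≡n
  where
  open XTAR P m G

  Δ≡n⇒cosingletons : tarMaxDegree P m G ≡ suc m → ∀ T → ∣ T ∣ ≡ m → X P m G T ≡ true
  Δ≡n⇒cosingletons Δ≡n T ∣T∣≡m with maxOver-attained (tarDegree P m G) (xSets P m G) Δ≡n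
  ... | S , S∈ , degS≡n with ⊆-or-adjacent-⊆ S T ∣T∣≡m
  ...   | inj₁ S⊆T = superset P m G S T (∈-xSets⁻ S∈) S⊆T
  ...   | inj₂ (S′ , d , S′⊆T) =
    superset P m G S′ T (Equivalence.to (tarDegree≡n⇔neighbours-XSets S) degS≡n S′ d) S′⊆T

  cosingletons⇒Δ≡n : (∀ T → ∣ T ∣ ≡ m → X P m G T ≡ true) → tarMaxDegree P m G ≡ suc m
  cosingletons⇒Δ≡n h = ≤-antisym
    (maxOver-lub (tarDegree P m G) (xSets P m G) (λ S _ → tarDegree≤n S))
    (subst (_≤ tarMaxDegree P m G) deg⊤≡n (≤-maxOver (tarDegree P m G) (xSets P m G) (∈-xSets⁺ ⊤-isXSet)))
    where
    deg⊤≡n : tarDegree P m G ⊤ ≡ suc m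
    deg⊤≡n = Equivalence.from (tarDegree≡n⇔neighbours-XSets ⊤) (λ S′ d → h S′ (∣⊤⊖p∣≡1⇒∣p∣≡n S′ d))
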